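{- Let $\Sigma$ be a signature, $T$ the effect-tree monad over $\Sigma$, and $\mathcal{E}\subseteq(T\mathbb{N})^2$ an algebraic relation which is reflexive, transitive, compositional and base-valued. Let $c$ be a choice function for $[\mathcal{E}_0]$ and $\alpha=\alpha_c$. Then $\alpha$ complements $\mathcal{E}$: for all $a,b\in T\mathbb{N}$, $a\sqsubseteq_\alpha b$ if and only if $a\,\mathcal{E}\,b$.
   Context: A signature $\Sigma$ is a set of operators with arities in $\mathbb{N}\cup\{\mathbb{N}\}$. For a set $X$, $TX$ is the set of possibly infinite-depth trees with leaves $\bot$, $\top$, or $\langle x\rangle$ ($x\in X$), and internal nodes labelled by operators $\sigma$ with $|\sigma|$ children (indexed by $\mathbb{N}$ if $|\sigma|=\mathbb{N}$). $T$ is a functor ($Tf$ relabels leaves) and a monad with $\eta(x)=\langle x\rangle$ and $\mu$ replacing each leaf $\langle t\rangle$ of a tree in $TTX$ by $t$; $f^*:=\mu\circ Tf$. Let $\mathbf{0}=\emptyset\subseteq\mathbb{N}$, so $T\mathbf{0}\subseteq T\mathbb{N}$ consists of trees with only $\bot,\top$ leaves. An algebraic relation is $\mathcal{E}\subseteq(T\mathbb{N})^2$, written $a\,\mathcal{E}\,b$; compositional means: if $a\,\mathcal{E}\,b$ and $f(n)\,\mathcal{E}\,g(n)$ for all $n$ ($f,g:\mathbb{N}\to T\mathbb{N}$), then $f^*(a)\,\mathcal{E}\,g^*(b)$; base-valued means: for all $a,b\in T\mathbb{N}$, if $f^*(a)\,\mathcal{E}\,f^*(b)$ for every $f:\mathbb{N}\to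 T\mathbf{0}$, then $a\,\mathcal{E}\,b$. Let $\mathcal{E}_0=\mathcal{E}\cap(T\mathbf{0})^2$, $[a]=\{b\in T\mathbf{0}\mid a\,\mathcal{E}_0\,b,\ b\,\mathcal{E}_0\,a\}$, $[\mathcal{E}_0]=\{[a]\mid a\in T\mathbf{0}\}$, ordered by $[a]\sqsubseteq[b]$ iff $a\,\mathcal{E}_0\,b$. A choice function is $c:[\mathcal{E}_0]\to T\mathbf{0}$ with $c(S)\in S$; $\alpha_c:=[-]\circ\mu_{\mathbf{0}}\circ Tc:T[\mathcal{E}_0]\to[\mathcal{E}_0]$. For $a,b\in T\mathbb{N}$: $a\sqsubseteq_\alpha b$ iff for every $h:\mathbb{N}\to[\mathcal{E}_0]$, $\alpha(Th(a))\sqsubseteq\alpha(Th(b))$. -}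

module Defs where

open import Level using (Level; 0ℓ)
open import Data.Nat using (_<_)
open import Data.List using (List; []; _∷_)
open import Data.Unit using (⊤)
open import Relation.Binary.PropositionalEquality using (_≡_)
open import Data.Nat using (ℕ)
open import Data.Fin using (Fin)
open import Data.Empty using (⊥; ⊥-elim)
open import Data.Product using (Σ; ∃; _×_; _,_; proj₁; proj₂)
open import Function using (_∘_; id; _⇔_)

-- Arities are elements of ℕ ∪ {ℕ}
data Arity : Set where
  fin   : ℕ → Arity
  omega : Arity

Pos : Arity → Set
Pos (fin n) = Fin n
Pos omega   = ℕ

record Signature : Set₁ where
  field
    Op    : Set
    arity : Op → Arity

-- the empty set 𝟎 (viewed as ∅ ⊆ ℕ)
𝟎 : Set
𝟎 = ⊥

module Trees (Sg : Signature) where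
  open Signature Sg

  data Shp {ℓ : Level} (X : Set ℓ) : Set ℓ where
    bot  : Shp X
    top  : Shp X
    leaf : X → Shp X
    op   : Op → Shp X

  Children : ∀ {ℓ} {X : Set ℓ} → Shp X → Set
  Children bot      = ⊥
  Children top      = ⊥
  Children (leaf _) = ⊥
  Children (op σ)   = Pos (arity σ)

  InRange : Arity → ℕ → Set
  InRange (fin n) i = i < n
  InRange omega   i = ⊤

  -- TX: possibly infinite-depth trees, encoded by their labelling
  -- function on addresses (finite lists of child indices).  t [] is the
  -- root label; the i-th child of the root is λ q → t (i ∷ q).
  -- Entries at addresses that are not valid paths of t are irrelevant
  -- junk; trees are identified up to _≈_ below.
  T : ∀ {ℓ} → Set ℓ → Set ℓ
  T X = List ℕ → Shp X

  child : ∀ {ℓ} {X : Set ℓ} → T X → ℕ → T X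
  child t i q = t (i ∷ q)

  data Valid {ℓ} {X : Set ℓ} : T X → List ℕ → Set ℓ where
    here  : ∀ {t} → Valid t []
    there : ∀ {t σ i p} → t [] ≡ op σ → InRange (arity σ) i →
            Valid (child t i) p → Valid t (i ∷ p)

  _≈_ : ∀ {ℓ} {X : Set ℓ} → T X → T X → Set ℓ
  t ≈ u = ∀ p → Valid t p → t p ≡ u p

  η : ∀ {ℓ} {X : Set ℓ} → X → T X
  η x _ = leaf x

  relabel : ∀ {ℓ ℓ'} {X : Set ℓ} {Y : Set ℓ'} → (X → Y) → Shp X → Shp Y
  relabel f bot      = bot
  relabel f top      = top
  relabel f (leaf x) = leaf (f x)
  relabel f (op σ)   = op σ

  Tmap : ∀ {ℓ ℓ'} {X : Set ℓ} {Y : Set ℓ'} → (X → Y) → T X → T Y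
  Tmap f t p = relabel f (t p)

  μ : ∀ {ℓ} {X : Set ℓ} → T (T X) → T X
  μ t []      with t []
  ... | bot    = bot
  ... | top    = top
  ... | leaf s = s []
  ... | op σ   = op σ
  μ t (i ∷ p) with t []
  ... | leaf s = s (i ∷ p)
  ... | op σ   = μ (child t i) p
  ... | bot    = bot
  ... | top    = bot

  _* : ∀ {ℓ ℓ'} {X : Set ℓ} {Y : Set ℓ'} → (X → T Y) → T X → T Y
  f * = μ ∘ Tmap f

  emb : T 𝟎 → T ℕ
  emb = Tmap ⊥-elim

  AlgRel : Set₁
  AlgRel = T ℕ → T ℕ → Set

  -- ℰ is a relation on trees, i.e. it respects tree equality
  RespectsTreeEq : AlgRel → Set
  RespectsTreeEq ℰ = ∀ a a' b b' → a ≈ a' → b ≈ b' → ℰ a b → ℰ a' b'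

  Reflexive : AlgRel → Set
  Reflexive ℰ = ∀ a → ℰ a a

  Transitive : AlgRel → Set
  Transitive ℰ = ∀ a b c → ℰ a b → ℰ b c → ℰ a c

  Compositional : AlgRel → Set
  Compositional ℰ = ∀ (a b : T ℕ) (f g : ℕ → T ℕ) →
    ℰ a b → (∀ n → ℰ (f n) (g n)) → ℰ ((f *) a) ((g *) b)

  BaseValued : AlgRel → Set
  BaseValued ℰ = ∀ (a b : T ℕ) →
    (∀ (f : ℕ → T 𝟎) → ℰ (((emb ∘ f) *) a) (((emb ∘ f) *) b)) → ℰ a b

  module Classes (ℰ : AlgRel) where
    ℰ₀ : T 𝟎 → T 𝟎 → Set
    ℰ₀ a b = ℰ (emb a) (emb b)

    ClassOf : T 𝟎 → T 𝟎 → Set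
    ClassOf a b = ℰ₀ a b × ℰ₀ b a

    -- [ℰ₀]: subsets of T𝟎 of the form [a]; a class carries a
    -- representative a and a proof that it coincides with [a]
    record Cls : Set₁ where
      field
        mem  : T 𝟎 → Set
        rep  : T 𝟎
        isCl : ∀ b → mem b ⇔ ClassOf rep b

    open Cls public

    [_] : T 𝟎 → Cls
    [ a ] = record { mem = ClassOf a ; rep = a ; isCl = λ b → Function.mk⇔ id id }

    _⊑_ : Cls → Cls → Set
    S ⊑ S' = ℰ₀ (rep S) (rep S')

    record ChoiceFunction : Set₁ where
      field
        choose   : Cls → T 𝟎
        chosenIn : ∀ S → mem S (choose S)

    open ChoiceFunction public

    α : ChoiceFunction → T Cls → Cls
    α c = [_] ∘ μ ∘ Tmap (choose c)

    _⊑[_]_ : T ℕ → ChoiceFunction → T ℕ → Set₁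
    a ⊑[ c ] b = ∀ (h : ℕ → Cls) → α c (Tmap h a) ⊑ α c (Tmap h b)

module Submission where

-- For h : ℕ → [ℰ₀], write ĥ = emb ∘ c ∘ h : ℕ → Tℕ for the substitution of
-- chosen representatives.  By naturality of the Kleisli extension,
-- α_c(Th(a)) is the class of ĥ*(a), so  a ⊑_α b  says exactly that
-- ĥ*(a) ℰ ĥ*(b) for every h.
--   (⇐) If a ℰ b then ĥ*(a) ℰ ĥ*(b) by compositionality (ĥ n ℰ ĥ n by
--       reflexivity).
--   (⇒) By base-valuedness it suffices to show f*(a) ℰ f*(b) for every
--       f : ℕ → T𝟎.  Taking h = [-] ∘ f, the substitutions f and ĥ are
--       pointwise ℰ-equivalent (c picks an element of [f n]), so by
--       compositionality  f*(a) ℰ ĥ*(a) ℰ ĥ*(b) ℰ f*(b), and transitivity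
--       concludes.

open import Defs
open import Function using (_⇔_; mk⇔; _∘_; Equivalence)
open import Data.Empty using (⊥-elim)
open import Data.Nat using (ℕ)
open import Data.List using (List; []; _∷_)
open import Data.Product using (proj₁; proj₂)
open import Relation.Binary.PropositionalEquality using (_≡_; refl; sym)

module Substitution (Sg : Signature) where
  open Trees Sg

  -- Stated
  -- pointwise at every address, since trees are labelling functions.
  Tmap-*-natural : ∀ {a b c d} {X : Set a} {Y : Set b} {Z : Set c} {W : Set d}
    (e : Z → W) (g : Y → T Z) (h : X → Y) (t : T X) (p : List ℕ) →
    Tmap e ((g *) (Tmap h t)) p ≡ ((Tmap e ∘ g ∘ h) *) t p
  Tmap-*-natural e g h t [] with t []
  ... | bot    = refl
  ... | top    = refl
  ... | leaf x = refl
  ... | op σ   = refl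
  Tmap-*-natural e g h t (i ∷ p) with t []
  ... | bot    = refl
  ... | top    = refl
  ... | leaf x = refl
  ... | op σ   = Tmap-*-natural e g h (child t i) p

  module Complement (ℰ : AlgRel) (resp : RespectsTreeEq ℰ)
                    (refl-ℰ : Reflexive ℰ) (trans-ℰ : Transitive ℰ)
                    (comp : Compositional ℰ) where
    open Classes ℰ

    substitute-mono : (f g : ℕ → T ℕ) → (∀ n → ℰ (f n) (g n)) →
                      ∀ a → ℰ ((f *) a) ((g *) a)
    substitute-mono f g fg a = comp a a f g (refl-ℰ a) fg

    representatives : ChoiceFunction → (ℕ → Cls) → ℕ → T ℕ
    representatives c h = emb ∘ choose c ∘ h

    α-⊑⇔ℰ-substituted : (c : ChoiceFunction) (h : ℕ → Cls) (a b : T ℕ) →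
      (α c (Tmap h a) ⊑ α c (Tmap h b)) ⇔
      ℰ ((representatives c h *) a) ((representatives c h *) b)
    α-⊑⇔ℰ-substituted c h a b = mk⇔
      (resp _ _ _ _ (λ p _ → natural a p) (λ p _ → natural b p))
      (resp _ _ _ _ (λ p _ → sym (natural a p)) (λ p _ → sym (natural b p)))
      where
      natural : ∀ t p → emb (μ (Tmap (choose c) (Tmap h t))) p ≡
                        (representatives c h *) t p
      natural t = Tmap-*-natural ⊥-elim (choose c) h t

    chosen-below : (c : ChoiceFunction) (f : ℕ → T 𝟎) (a : T ℕ) →
      ℰ (((emb ∘ f) *) a) ((representatives c ([_] ∘ f) *) a)
    chosen-below c f = substitute-mono _ _ (λ n → proj₁ (chosenIn c [ f n ]))

    chosen-above : (c : ChoiceFunction) (f : ℕ → T 𝟎) (a : T ℕ) →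
      ℰ ((representatives c ([_] ∘ f) *) a) (((emb ∘ f) *) a)
    chosen-above c f = substitute-mono _ _ (λ n → proj₂ (chosenIn c [ f n ]))

    ℰ⇒⊑α : (c : ChoiceFunction) → ∀ a b → ℰ a b → a ⊑[ c ] b
    ℰ⇒⊑α c a b ab h = Equivalence.from (α-⊑⇔ℰ-substituted c h a b)
      (comp a b ĥ ĥ ab (λ n → refl-ℰ (ĥ n)))
      where ĥ = representatives c h

    ⊑α⇒ℰ : BaseValued ℰ → (c : ChoiceFunction) → ∀ a b → a ⊑[ c ] b → ℰ a b
    ⊑α⇒ℰ base c a b a⊑b = base a b λ f →
      let h = [_] ∘ f in
      trans-ℰ _ _ _ (chosen-below c f a)
        (trans-ℰ _ _ _ (Equivalence.to (α-⊑⇔ℰ-substituted c h a b) (a⊑b h))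
                       (chosen-above c f b))

mainTheorem8 : (Sg : Signature) (ℰ : Trees.AlgRel Sg) →
    Trees.RespectsTreeEq Sg ℰ →
    Trees.Reflexive Sg ℰ → Trees.Transitive Sg ℰ →
    Trees.Compositional Sg ℰ → Trees.BaseValued Sg ℰ →
    (c : Trees.Classes.ChoiceFunction Sg ℰ) →
    ∀ a b → (Trees.Classes._⊑[_]_ Sg ℰ a c b ⇔ ℰ a b)
mainTheorem8 Sg ℰ resp refl-ℰ trans-ℰ comp base c a b =
  mk⇔ (⊑α⇒ℰ base c a b) (ℰ⇒⊑α c a b)
  where open Substitution.Complement Sg ℰ resp refl-ℰ trans-ℰ comp
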